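{- Let $n \ge 3$, let $H$ be a connected graph, let $A \subseteq V(C_n)$ with $|A| \ge 2$, and let $\emptyset \neq B \subseteq \bigcup_{w\in V(C_n)} V(H_w)$. If $S = A\cup B$ is a mutual-visibility set of $C_n \odot H$, then $|A| = 2$.
   Context: All graphs are finite, simple, undirected and connected; $C_n$ is the cycle on $n$ vertices. For a graph $G$ and $X \subseteq V(G)$, two vertices $u,v$ are $X$-visible if there exists a shortest $(u,v)$-path $P$ in $G$ with $V(P)\cap X \subseteq \{u,v\}$. A set $X\subseteq V(G)$ is a mutual-visibility set of $G$ if every two vertices of $X$ are $X$-visible. The corona $G\odot H$ is obtained from one copy of $G$ and $|V(G)|$ copies of $H$, the copy associated with $v\in V(G)$ being denoted $H_v$, by joining each $v \in V(G)$ to every vertex of $H_v$. -}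

module Defs where

open import Data.Nat using (ℕ; zero; suc; _≤_)
open import Data.Fin using (Fin; toℕ)
open import Data.Product using (_×_; Σ; ∃; _,_)
open import Data.Sum using (_⊎_; inj₁; inj₂)
open import Relation.Binary.PropositionalEquality using (_≡_; _≢_)
open import Relation.Nullary using (¬_)

data Walk {V : Set} (E : V → V → Set) : V → V → Set where
  []  : ∀ {u} → Walk E u u
  _∷_ : ∀ {u w v} → E u w → Walk E w v → Walk E u v

len : ∀ {V : Set} {E : V → V → Set} {u v : V} → Walk E u v → ℕ
len []      = zero
len (_ ∷ p) = suc (len p)

data _∈W_ {V : Set} {E : V → V → Set} (x : V) : ∀ {u v : V} → Walk E u v → Set where
  here  : ∀ {u v} {p : Walk E u v} → x ≡ u → x ∈W p
  there : ∀ {u w v} {e : E u w} {p : Walk E w v} → x ∈W p → x ∈W (e ∷ p)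

-- a shortest (u,v)-path: a (u,v)-walk no longer than any other (u,v)-walk
-- (such a walk automatically has no repeated vertices)
IsShortest : ∀ {V : Set} {E : V → V → Set} {u v : V} → Walk E u v → Set
IsShortest {E = E} {u} {v} p = ∀ (q : Walk E u v) → len p ≤ len q

Visible : ∀ {V : Set} (E : V → V → Set) (X : V → Set) (u v : V) → Set
Visible E X u v =
  Σ (Walk E u v) λ p → IsShortest p ×
    (∀ x → x ∈W p → X x → (x ≡ u) ⊎ (x ≡ v))

IsMutualVisibilitySet : ∀ {V : Set} (E : V → V → Set) (X : V → Set) → Set
IsMutualVisibilitySet {V} E X =
  ∀ (u v : V) → X u → X v → u ≢ v → Visible E X u v

record SimpleGraph (m : ℕ) : Set₁ where
  field
    Adj     : Fin m → Fin m → Set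
    symm    : ∀ {x y} → Adj x y → Adj y x
    irrefl  : ∀ {x} → ¬ Adj x x

Connected : ∀ {m} → SimpleGraph m → Set
Connected {m} H = ∀ (x y : Fin m) → Walk (SimpleGraph.Adj H) x y

CycleAdj : (n : ℕ) → Fin n → Fin n → Set
CycleAdj n i j =
    (toℕ j ≡ suc (toℕ i))
  ⊎ (toℕ i ≡ suc (toℕ j))
  ⊎ ((toℕ i ≡ 0) × (suc (toℕ j) ≡ n))
  ⊎ ((toℕ j ≡ 0) × (suc (toℕ i) ≡ n))

-- The corona C_n ⊙ H.  Vertices: inj₁ v  (v ∈ V(C_n)) and
-- inj₂ (w , h)  (vertex h of the copy H_w).

CoronaV : ℕ → ℕ → Set
CoronaV n m = Fin n ⊎ (Fin n × Fin m)

CoronaAdj : ∀ n {m} → SimpleGraph m → CoronaV n m → CoronaV n m → Set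
CoronaAdj n H (inj₁ i)       (inj₁ j)       = CycleAdj n i j
CoronaAdj n H (inj₁ i)       (inj₂ (w , h)) = i ≡ w
CoronaAdj n H (inj₂ (w , h)) (inj₁ i)       = i ≡ w
CoronaAdj n H (inj₂ (w , h)) (inj₂ (w' , h')) =
  (w ≡ w') × SimpleGraph.Adj H h h'

open import Data.Fin.Subset using (Subset; _∈_)

-- S = A ∪ B as a predicate on V(C_n ⊙ H), where A ⊆ V(C_n) and
-- B is given copywise: B w ⊆ V(H_w).
UnionAB : ∀ {n m} → Subset n → (Fin n → Subset m) → CoronaV n m → Set
UnionAB A B (inj₁ v)       = v ∈ A
UnionAB A B (inj₂ (w , h)) = h ∈ B w

{-# OPTIONS --safe #-}
-- Every walk from a vertex of H_w to the cycle passes through w, and every walk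
-- leaving an open arc of C_n (together with the copies of H hanging from it)
-- passes through an end of the arc.  So for b ∈ V(H_w) ∩ S: if w ∈ A, then w
-- blocks b from every other vertex of A; if w ∉ A and |A| ≥ 3, three vertices
-- of A cut the cycle into arcs, and two of them are the ends of an arc that
-- separates b from the third.
module Submission where

open import Defs
open import Data.Nat using (ℕ; _≤_; _≥_)
open import Data.Fin using (Fin)
open import Data.Fin.Subset using (Subset; _∈_; ∣_∣)
open import Data.Product using (_×_; ∃; ∃₂; _,_)
open import Data.Sum using (_⊎_; inj₁; inj₂)
open import Relation.Binary.PropositionalEquality using (_≡_)

open import Data.Bool using (true; false)
open import Data.Empty using (⊥-elim)
open import Data.Fin using (zero; suc; toℕ; _<_; _≟_)
open import Data.Fin.Properties
  using (toℕ-injective; toℕ<n; <-asym; <-irrefl; <⇒≢; _<?_; <-strictTotalOrder)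
open import Data.Fin.Subset using (_∉_; Nonempty)
open import Data.Fin.Subset.Properties using (_∈?_)
import Data.Nat as ℕ
import Data.Nat.Properties as ℕ
open import Data.Product using (proj₁; proj₂; map₂)
import Data.Sum as Sum
open import Data.Vec.Base using (_∷_; here; there)
open import Function using (_∘_)
open import Relation.Binary using (StrictTotalOrder; tri<; tri≈; tri>)
open import Relation.Binary.PropositionalEquality using (refl; sym; cong; subst; _≢_)
open import Relation.Nullary using (¬_; yes; no)
open import Relation.Nullary.Decidable using (_×-dec_)
open import Relation.Unary using (Decidable)

module _ {V : Set} where

  Separates : (E : V → V → Set) (X : V → Set) (u v : V) → Set
  Separates E X u v = (p : Walk E u v) → ∃ λ x → x ∈W p × X x × x ≢ u × x ≢ v

  walk-exit : ∀ {E : V → V → Set} {In Bd : V → Set} → Decidable In →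
    (∀ {u v} → E u v → In u → ¬ In v → Bd v) →
    ∀ {u v} (p : Walk E u v) → In u → ¬ In v → ∃ λ x → x ∈W p × Bd x
  walk-exit in? exit [] u∈ u∉ = ⊥-elim (u∉ u∈)
  walk-exit in? exit (_∷_ {w = w} e p) u∈ v∉ with in? w
  ... | yes w∈ = map₂ (λ (x∈p , bd) → there x∈p , bd) (walk-exit in? exit p w∈ v∉)
  ... | no w∉ = w , there (here refl) , exit e u∈ w∉

  separated⇒¬visible : ∀ {E X u v} → Separates E X u v → ¬ Visible E X u v
  separated⇒¬visible sep (p , _ , avoids) with sep p
  ... | x , x∈p , x∈X , x≢u , x≢v with avoids x x∈p x∈X
  ...   | inj₁ x≡u = x≢u x≡u
  ...   | inj₂ x≡v = x≢v x≡v

  separated⇒≢ : ∀ {E X u v} → Separates E X u v → u ≢ v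
  separated⇒≢ sep refl with sep []
  ... | _ , here x≡u , _ , x≢u , _ = x≢u x≡u

  separated⇒¬mutual-visibility : ∀ {E X u v} → IsMutualVisibilitySet E X →
    X u → X v → ¬ Separates E X u v
  separated⇒¬mutual-visibility mv u∈X v∈X sep =
    separated⇒¬visible sep (mv _ _ u∈X v∈X (separated⇒≢ sep))

module _ {a ℓ₁ ℓ₂} (O : StrictTotalOrder a ℓ₁ ℓ₂) where
  open StrictTotalOrder O using (_≈_; compare; asym; module Eq) renaming (_<_ to _≺_)

  position-in-triple : ∀ {x y z w} → x ≺ y → y ≺ z →
    ¬ w ≈ x → ¬ w ≈ y → ¬ w ≈ z →
    (x ≺ w × w ≺ y) ⊎ (y ≺ w × w ≺ z) ⊎ ¬ (x ≺ w × w ≺ z)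
  position-in-triple {x} {y} {z} {w} x<y y<z w≉x w≉y w≉z with compare w y
  ... | tri≈ _ w≈y _ = ⊥-elim (w≉y w≈y)
  ... | tri< w<y _ _ with compare x w
  ...   | tri< x<w _ _ = inj₁ (x<w , w<y)
  ...   | tri≈ _ x≈w _ = ⊥-elim (w≉x (Eq.sym x≈w))
  ...   | tri> _ _ w<x = inj₂ (inj₂ λ (x<w , _) → asym x<w w<x)
  position-in-triple {x} {y} {z} {w} x<y y<z w≉x w≉y w≉z | tri> _ _ y<w with compare w z
  ...   | tri< w<z _ _ = inj₂ (inj₁ (y<w , w<z))
  ...   | tri≈ _ w≈z _ = ⊥-elim (w≉z w≈z)
  ...   | tri> _ _ z<w = inj₂ (inj₂ λ (_ , w<z) → asym w<z z<w)

∣p∣≥1⇒Nonempty : ∀ {n} {p : Subset n} → ∣ p ∣ ≥ 1 → Nonempty p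
∣p∣≥1⇒Nonempty {p = true ∷ p} _ = zero , here
∣p∣≥1⇒Nonempty {p = false ∷ p} ∣p∣≥1 with ∣p∣≥1⇒Nonempty ∣p∣≥1
... | x , x∈p = suc x , there x∈p

∣p∣≥2⇒increasing-pair : ∀ {n} {p : Subset n} → ∣ p ∣ ≥ 2 →
  ∃₂ λ x y → x ∈ p × y ∈ p × x < y
∣p∣≥2⇒increasing-pair {p = true ∷ p} (ℕ.s≤s ∣p∣≥1) with ∣p∣≥1⇒Nonempty ∣p∣≥1
... | y , y∈p = zero , suc y , here , there y∈p , ℕ.z<s
∣p∣≥2⇒increasing-pair {p = false ∷ p} ∣p∣≥2 with ∣p∣≥2⇒increasing-pair ∣p∣≥2
... | x , y , x∈p , y∈p , x<y = suc x , suc y , there x∈p , there y∈p , ℕ.s<s x<y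

∣p∣≥3⇒increasing-triple : ∀ {n} {p : Subset n} → ∣ p ∣ ≥ 3 →
  ∃₂ λ x y → ∃ λ z → x ∈ p × y ∈ p × z ∈ p × x < y × y < z
∣p∣≥3⇒increasing-triple {p = true ∷ p} (ℕ.s≤s ∣p∣≥2) with ∣p∣≥2⇒increasing-pair ∣p∣≥2
... | y , z , y∈p , z∈p , y<z =
  zero , suc y , suc z , here , there y∈p , there z∈p , ℕ.z<s , ℕ.s<s y<z
∣p∣≥3⇒increasing-triple {p = false ∷ p} ∣p∣≥3 with ∣p∣≥3⇒increasing-triple ∣p∣≥3
... | x , y , z , x∈p , y∈p , z∈p , x<y , y<z =
  suc x , suc y , suc z , there x∈p , there y∈p , there z∈p , ℕ.s<s x<y , ℕ.s<s y<z

∃-other-element : ∀ {n} {p : Subset n} w → ∣ p ∣ ≥ 2 → ∃ λ x → x ∈ p × x ≢ w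
∃-other-element w ∣p∣≥2 with ∣p∣≥2⇒increasing-pair ∣p∣≥2
... | x , y , x∈p , y∈p , x<y with x ≟ w
...   | yes refl = y , y∈p , <⇒≢ x<y ∘ sym
...   | no x≢w = x , x∈p , x≢w

exit-upwards : ∀ {a i j b : ℕ} → j ≡ ℕ.suc i → a ℕ.< i → i ℕ.< b →
  ¬ (a ℕ.< j × j ℕ.< b) → j ≡ b
exit-upwards refl a<i i<b j∉ =
  ℕ.≤-antisym i<b (ℕ.≮⇒≥ λ j<b → j∉ (ℕ.m<n⇒m<1+n a<i , j<b))

exit-downwards : ∀ {a i j b : ℕ} → i ≡ ℕ.suc j → a ℕ.< i → i ℕ.< b →
  ¬ (a ℕ.< j × j ℕ.< b) → j ≡ a
exit-downwards refl a<i i<b j∉ =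
  ℕ.≤-antisym (ℕ.≮⇒≥ λ a<j → j∉ (a<j , ℕ.<-trans (ℕ.n<1+n _) i<b)) (ℕ.s≤s⁻¹ a<i)

cycle-arc-exit : ∀ {n} {lo hi i j : Fin n} → CycleAdj n i j →
  lo < i → i < hi → ¬ (lo < j × j < hi) → j ≡ lo ⊎ j ≡ hi
cycle-arc-exit (inj₁ j≡1+i) lo<i i<hi j∉ =
  inj₂ (toℕ-injective (exit-upwards j≡1+i lo<i i<hi j∉))
cycle-arc-exit (inj₂ (inj₁ i≡1+j)) lo<i i<hi j∉ =
  inj₁ (toℕ-injective (exit-downwards i≡1+j lo<i i<hi j∉))
cycle-arc-exit {lo = lo} (inj₂ (inj₂ (inj₁ (i≡0 , _)))) lo<i i<hi j∉ =
  ⊥-elim (ℕ.n≮0 (subst (toℕ lo ℕ.<_) i≡0 lo<i))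
cycle-arc-exit {hi = hi} (inj₂ (inj₂ (inj₂ (_ , 1+i≡n)))) lo<i i<hi j∉ =
  ⊥-elim (ℕ.<-irrefl 1+i≡n (ℕ.≤-<-trans i<hi (toℕ<n hi)))

module Corona {n m : ℕ} (H : SimpleGraph m) where

  private
    V : Set
    V = CoronaV n m

    _~_ : V → V → Set
    _~_ = CoronaAdj n H

  base : V → Fin n
  base (inj₁ i) = i
  base (inj₂ (w , _)) = w

  InArc : Fin n → Fin n → V → Set
  InArc lo hi x = lo < base x × base x < hi

  inArc? : ∀ lo hi → Decidable (InArc lo hi)
  inArc? lo hi x = (lo <? base x) ×-dec (base x <? hi)

  arc-exit : ∀ {lo hi u v} → u ~ v → InArc lo hi u → ¬ InArc lo hi v →
    v ≡ inj₁ lo ⊎ v ≡ inj₁ hi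
  arc-exit {u = inj₁ _} {inj₁ _} e (lo<i , i<hi) v∉ =
    Sum.map (cong inj₁) (cong inj₁) (cycle-arc-exit e lo<i i<hi v∉)
  arc-exit {u = inj₁ _} {inj₂ _} refl u∈ v∉ = ⊥-elim (v∉ u∈)
  arc-exit {u = inj₂ _} {inj₁ _} refl u∈ v∉ = ⊥-elim (v∉ u∈)
  arc-exit {u = inj₂ _} {inj₂ _} (refl , _) u∈ v∉ = ⊥-elim (v∉ u∈)

  arc-ends-separate : ∀ {X lo hi u v} → X (inj₁ lo) → X (inj₁ hi) →
    InArc lo hi u → ¬ InArc lo hi v → v ≢ inj₁ lo → v ≢ inj₁ hi →
    Separates _~_ X u v
  arc-ends-separate lo∈X hi∈X u∈ v∉ v≢lo v≢hi p
    with walk-exit (inArc? _ _) arc-exit p u∈ v∉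
  ... | x , x∈p , inj₁ refl =
    x , x∈p , lo∈X , (λ { refl → <-irrefl refl (proj₁ u∈) }) , v≢lo ∘ sym
  ... | x , x∈p , inj₂ refl =
    x , x∈p , hi∈X , (λ { refl → <-irrefl refl (proj₂ u∈) }) , v≢hi ∘ sym

  copy-walk-meets-base : ∀ {w h a} (p : Walk _~_ (inj₂ (w , h)) (inj₁ a)) → inj₁ w ∈W p
  copy-walk-meets-base (_∷_ {w = inj₁ _} refl _) = there (here refl)
  copy-walk-meets-base (_∷_ {w = inj₂ _} (refl , _) p) = there (copy-walk-meets-base p)

  base-separates-copy : ∀ {X w h a} → X (inj₁ w) → a ≢ w →
    Separates _~_ X (inj₂ (w , h)) (inj₁ a)
  base-separates-copy w∈X a≢w p =
    _ , copy-walk-meets-base p , w∈X , (λ ()) , λ { refl → a≢w refl }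

  module _ {A : Subset n} {B : Fin n → Subset m} {w h} (h∈B : h ∈ B w) where

    private
      b : V
      b = inj₂ (w , h)

    ¬mutual-visibility-base∈A : w ∈ A → ∣ A ∣ ≥ 2 →
      ¬ IsMutualVisibilitySet _~_ (UnionAB A B)
    ¬mutual-visibility-base∈A w∈A ∣A∣≥2 mv with ∃-other-element w ∣A∣≥2
    ... | a , a∈A , a≢w =
      separated⇒¬mutual-visibility {u = b} {v = inj₁ a} mv h∈B a∈A
        (base-separates-copy w∈A a≢w)

    ¬mutual-visibility-base∉A : w ∉ A → ∣ A ∣ ≥ 3 →
      ¬ IsMutualVisibilitySet _~_ (UnionAB A B)
    ¬mutual-visibility-base∉A w∉A ∣A∣≥3 mv with ∣p∣≥3⇒increasing-triple ∣A∣≥3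
    ... | x , y , z , x∈A , y∈A , z∈A , x<y , y<z
      with position-in-triple (<-strictTotalOrder n) x<y y<z
             (λ { refl → w∉A x∈A }) (λ { refl → w∉A y∈A }) (λ { refl → w∉A z∈A })
    ... | inj₁ w∈⟨x,y⟩ =
      separated⇒¬mutual-visibility {u = b} {v = inj₁ z} mv h∈B z∈A
        (arc-ends-separate x∈A y∈A w∈⟨x,y⟩ (λ (_ , z<y) → <-asym y<z z<y)
          (λ { refl → <-asym x<y y<z }) (λ { refl → <-irrefl refl y<z }))
    ... | inj₂ (inj₁ w∈⟨y,z⟩) =
      separated⇒¬mutual-visibility {u = b} {v = inj₁ x} mv h∈B x∈A
        (arc-ends-separate y∈A z∈A w∈⟨y,z⟩ (λ (y<x , _) → <-asym x<y y<x)
          (λ { refl → <-irrefl refl x<y }) (λ { refl → <-asym x<y y<z }))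
    ... | inj₂ (inj₂ w∉⟨x,z⟩) =
      separated⇒¬mutual-visibility {u = inj₁ y} {v = b} mv y∈A h∈B
        (arc-ends-separate x∈A z∈A (x<y , y<z) w∉⟨x,z⟩ (λ ()) (λ ()))

open Corona using (¬mutual-visibility-base∈A; ¬mutual-visibility-base∉A)

mainTheorem13 : (n m : ℕ) → n ≥ 3 → (H : SimpleGraph m) → Connected H →
    (A : Subset n) → ∣ A ∣ ≥ 2 →
    (B : Fin n → Subset m) → (∃₂ λ w h → h ∈ B w) →
    IsMutualVisibilitySet (CoronaAdj n H)
      (UnionAB A B) →
    ∣ A ∣ ≡ 2
mainTheorem13 n m _ H _ A ∣A∣≥2 B (w , h , h∈B) mv with ∣ A ∣ ℕ.≟ 2 | w ∈? A
... | yes ∣A∣≡2 | _ = ∣A∣≡2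
... | no ∣A∣≢2 | yes w∈A = ⊥-elim (¬mutual-visibility-base∈A H h∈B w∈A ∣A∣≥2 mv)
... | no ∣A∣≢2 | no w∉A = ⊥-elim (¬mutual-visibility-base∉A H h∈B w∉A ∣A∣≥3 mv)
  where
  ∣A∣≥3 : ∣ A ∣ ≥ 3
  ∣A∣≥3 = ℕ.≤∧≢⇒< ∣A∣≥2 (∣A∣≢2 ∘ sym)
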